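{- Let $\mathbf{t}=t_0't_1't_2'\cdots$ be the Tribonacci word, indexed from $0$, and write $\mathbf{t}[i\ldots j]$ for the factor $t_i'\cdots t_j'$. For every integer $k\ge2$, with $L=\frac{T_{k+1}+T_{k-1}-3}{2}$, $\mathbf{t}[0\ldots L-1]=\mathbf{t}[T_k\ldots T_k+L-1].$
   Context: The Tribonacci word is $\mathbf{t}=\sigma^{\omega}(0)$, the fixed point of $\sigma(0)=01$, $\sigma(1)=02$, $\sigma(2)=0$. Tribonacci numbers: $T_{ -1}=1$, $T_0=1$, $T_1=2$, $T_2=4$, $T_k=T_{k-1}+T_{k-2}+T_{k-3}$ for $k\ge3$. -}

module Defs where

open import Data.Nat using (ℕ; zero; suc; _+_; _∸_; _/_)
open import Data.Fin using (Fin; zero; suc)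
open import Data.List using (List; []; _∷_; _++_; concatMap)
open import Data.Maybe using (Maybe; just; nothing)

σ : Fin 3 → List (Fin 3)
σ zero = zero ∷ suc zero ∷ []
σ (suc zero) = zero ∷ suc (suc zero) ∷ []
σ (suc (suc zero)) = zero ∷ []

σ* : List (Fin 3) → List (Fin 3)
σ* = concatMap σ

σⁿ0 : ℕ → List (Fin 3)
σⁿ0 zero = zero ∷ []
σⁿ0 (suc m) = σ* (σⁿ0 m)

_‼_ : List (Fin 3) → ℕ → Maybe (Fin 3)
[] ‼ _ = nothing
(x ∷ xs) ‼ zero = just x
(x ∷ xs) ‼ suc i = xs ‼ i

-- Tribonacci word t = σ^ω(0), indexed from 0: t i is the i-th letter of
-- σ^(i+1)(0), which has length > i and is a prefix of σ^ω(0).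
-- (The value 'nothing' never occurs.)
t : ℕ → Maybe (Fin 3)
t i = (σⁿ0 (suc i)) ‼ i

-- Tribonacci numbers with the paper's shifted indexing:
-- T k = T_k for k ≥ -1 is encoded as T₋ (k+1):
-- T₋ 0 = T_{-1} = 1, T₋ 1 = T_0 = 1, T₋ 2 = T_1 = 2, T₋ 3 = T_2 = 4,
-- and the recurrence T_k = T_{k-1} + T_{k-2} + T_{k-3} beyond.
T₋ : ℕ → ℕ
T₋ 0 = 1
T₋ 1 = 1
T₋ 2 = 2
T₋ 3 = 4
T₋ (suc (suc (suc (suc n)))) = T₋ (suc (suc (suc n))) + T₋ (suc (suc n)) + T₋ (suc n)

T : ℕ → ℕ
T k = T₋ (suc k)

-- L = (T_{k+1} + T_{k-1} - 3) / 2  (the numerator is always even for k ≥ 2)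
Lk : ℕ → ℕ
Lk k = (T (suc k) + T₋ k ∸ 3) / 2

module Submission where

-- Write Sₙ = σⁿ(0).  Then |Sₙ| = Tₙ, each Sₙ is a prefix of
-- Sₙ₊₁ (so all of them are prefixes of t), and Sₙ₊₃ = Sₙ₊₂ Sₙ₊₁ Sₙ.
-- Reading this factorisation of a prefix of t gives two "block shifts":
--   t[T(n+2) + i] = t[i]           for i < T(n+1),
--   t[T(n+2) + T(n+1) + i] = t[i]  for i < T n.
-- Say that positions p and q of t agree on length ℓ if the factors of t of
-- length ℓ starting at p and q coincide; agreement is symmetric, transitive,
-- inherited by shorter lengths and can be concatenated.  For k ≥ 5 one has
-- L_k = T_{k-1} + T_{k-2} + (T_{k-3} + L_{k-3}), and on each of these three
-- pieces the agreement of 0 and T_k follows from block shifts (and, on the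
-- last piece, from the statement for k - 3).  This gives an induction on k
-- in steps of 3, whose base cases k = 2, 3, 4 are checked by computation on
-- the prefix S₆ of length 44.

open import Defs
open import Data.Nat using (ℕ; _+_; _≤_; _<_)
open import Relation.Binary.PropositionalEquality using (_≡_)

open import Data.Nat using (zero; suc; _*_; _∸_; _/_; _≤′_; ≤′-refl; ≤′-step; z≤n; s≤s; _≤?_; _<?_)
open import Data.Nat.Properties
  using (≤-trans; ≤-reflexive; <-≤-trans; ≤-<-trans; ≤-total; ≤⇒≤′; ≮⇒≥;
         +-assoc; +-comm; +-mono-≤; +-monoˡ-≤; +-monoʳ-≤; +-monoʳ-<; +-cancelˡ-<; +-∸-assoc;
         m≤m+n; m≤n+m; m<m+n; m+[n∸m]≡n; m∸n≤m; <⇒≤; allUpTo?)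
open import Data.Nat.DivMod using (m*n/n≡m; +-distrib-/-∣ˡ; /-monoˡ-≤)
open import Data.Nat.Divisibility using (n∣m*n)
open import Data.Nat.Tactic.RingSolver using (solve-∀)
open import Data.Fin as Fin using (Fin)
open import Data.Fin.Properties using () renaming (_≟_ to _≟ᶠ_)
open import Data.List using (List; []; _∷_; _++_; length)
open import Data.List.Properties using (concatMap-++; length-++; length-++-≤ˡ; ++-assoc; ++-identityʳ)
open import Data.Maybe.Properties using (≡-dec)
open import Data.Product using (∃; _×_; _,_)
open import Data.Sum using (inj₁; inj₂)
open import Relation.Binary.PropositionalEquality
  using (refl; sym; trans; cong; cong₂; subst; subst₂; module ≡-Reasoning)
open import Relation.Nullary using (Dec; yes; no)
open import Relation.Nullary.Decidable using (from-yes; _×-dec_)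

open ≡-Reasoning

T-pos : ∀ n → 0 < T n
T-pos 0 = s≤s z≤n
T-pos 1 = s≤s z≤n
T-pos 2 = s≤s z≤n
T-pos (suc (suc (suc n))) = ≤-trans (T-pos (suc (suc n))) (≤-trans (m≤m+n _ (T (1 + n))) (m≤m+n _ (T n)))

T-strict : ∀ n → T n < T (suc n)
T-strict 0 = s≤s (s≤s z≤n)
T-strict 1 = s≤s (s≤s (s≤s z≤n))
T-strict (suc (suc n)) = <-≤-trans (m<m+n (T (2 + n)) (T-pos (1 + n))) (m≤m+n _ (T n))

T-mono : ∀ n → T n ≤ T (suc n)
T-mono n = <⇒≤ (T-strict n)

n<T : ∀ n → n < T n
n<T zero = s≤s z≤n
n<T (suc n) = ≤-<-trans (n<T n) (T-strict n)

-- Sₙ₊₃ = Sₙ₊₂ Sₙ₊₁ Sₙ, by applying σ to the identity S₃ = 0102010 = S₂ S₁ S₀.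
S-rec : ∀ n → σⁿ0 (3 + n) ≡ σⁿ0 (2 + n) ++ σⁿ0 (1 + n) ++ σⁿ0 n
S-rec zero = refl
S-rec (suc n) = begin
  σ* (σⁿ0 (3 + n))                                   ≡⟨ cong σ* (S-rec n) ⟩
  σ* (σⁿ0 (2 + n) ++ σⁿ0 (1 + n) ++ σⁿ0 n)           ≡⟨ concatMap-++ σ (σⁿ0 (2 + n)) _ ⟩
  σⁿ0 (3 + n) ++ σ* (σⁿ0 (1 + n) ++ σⁿ0 n)           ≡⟨ cong (σⁿ0 (3 + n) ++_) (concatMap-++ σ (σⁿ0 (1 + n)) _) ⟩
  σⁿ0 (3 + n) ++ σⁿ0 (2 + n) ++ σⁿ0 (1 + n)          ∎

length-S : ∀ n → length (σⁿ0 n) ≡ T n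
length-S 0 = refl
length-S 1 = refl
length-S 2 = refl
length-S (suc (suc (suc n))) = begin
  length (σⁿ0 (3 + n))                                   ≡⟨ cong length (S-rec n) ⟩
  length (σⁿ0 (2 + n) ++ σⁿ0 (1 + n) ++ σⁿ0 n)           ≡⟨ length-++ (σⁿ0 (2 + n)) ⟩
  length (σⁿ0 (2 + n)) + length (σⁿ0 (1 + n) ++ σⁿ0 n)  ≡⟨ cong (length (σⁿ0 (2 + n)) +_) (length-++ (σⁿ0 (1 + n))) ⟩
  length (σⁿ0 (2 + n)) + (length (σⁿ0 (1 + n)) + length (σⁿ0 n))
    ≡⟨ sym (+-assoc (length (σⁿ0 (2 + n))) _ _) ⟩
  length (σⁿ0 (2 + n)) + length (σⁿ0 (1 + n)) + length (σⁿ0 n)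
    ≡⟨ cong₂ _+_ (cong₂ _+_ (length-S (suc (suc n))) (length-S (suc n))) (length-S n) ⟩
  T (3 + n)                                              ∎

_⊑_ : List (Fin 3) → List (Fin 3) → Set
xs ⊑ ys = ∃ λ zs → ys ≡ xs ++ zs

⊑-trans : ∀ {xs ys zs} → xs ⊑ ys → ys ⊑ zs → xs ⊑ zs
⊑-trans {xs} (us , refl) (vs , refl) = us ++ vs , ++-assoc xs us vs

σ*-mono-⊑ : ∀ {xs ys} → xs ⊑ ys → σ* xs ⊑ σ* ys
σ*-mono-⊑ {xs} (zs , refl) = σ* zs , concatMap-++ σ xs zs

-- Sₙ ⊑ Sₙ₊₁ (from S₀ = 0 ⊑ 01 = S₁ by applying σ), hence Sₘ ⊑ Sₙ for m ≤ n.
S-⊑-suc : ∀ n → σⁿ0 n ⊑ σⁿ0 (suc n)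
S-⊑-suc zero = Fin.suc Fin.zero ∷ [] , refl
S-⊑-suc (suc n) = σ*-mono-⊑ {σⁿ0 n} (S-⊑-suc n)

S-⊑ : ∀ {m n} → m ≤′ n → σⁿ0 m ⊑ σⁿ0 n
S-⊑ ≤′-refl = [] , sym (++-identityʳ _)
S-⊑ {m} (≤′-step {n} m≤′n) = ⊑-trans {σⁿ0 m} (S-⊑ m≤′n) (S-⊑-suc n)

‼-⊑ : ∀ {xs ys} i → xs ⊑ ys → i < length xs → ys ‼ i ≡ xs ‼ i
‼-⊑ {x ∷ xs} zero (zs , refl) _ = refl
‼-⊑ {x ∷ xs} (suc i) (zs , refl) (s≤s i<n) = ‼-⊑ {xs} i (zs , refl) i<n

‼-++ʳ : ∀ (xs ys : List (Fin 3)) i → (xs ++ ys) ‼ (length xs + i) ≡ ys ‼ i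
‼-++ʳ [] ys i = refl
‼-++ʳ (x ∷ xs) ys i = ‼-++ʳ xs ys i

S-coherent : ∀ m n i → i < T m → i < T n → σⁿ0 m ‼ i ≡ σⁿ0 n ‼ i
S-coherent m n i i<Tm i<Tn with ≤-total m n
... | inj₁ m≤n = sym (‼-⊑ i (S-⊑ (≤⇒≤′ m≤n)) (subst (i <_) (sym (length-S m)) i<Tm))
... | inj₂ n≤m = ‼-⊑ i (S-⊑ (≤⇒≤′ n≤m)) (subst (i <_) (sym (length-S n)) i<Tn)

Occurs : List (Fin 3) → ℕ → Set
Occurs w p = ∀ i → i < length w → t (p + i) ≡ w ‼ i

S-occurs : ∀ n → Occurs (σⁿ0 n) 0
S-occurs n i i<len = S-coherent (suc i) n i (≤-trans (n<T i) (T-mono i)) (subst (i <_) (length-S n) i<len)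

occurs-++ˡ : ∀ u v {p} → Occurs (u ++ v) p → Occurs u p
occurs-++ˡ u v occ i i<u =
  trans (occ i (<-≤-trans i<u (length-++-≤ˡ u))) (‼-⊑ {u} i (v , refl) i<u)

occurs-++ʳ : ∀ u v {p} → Occurs (u ++ v) p → Occurs v (p + length u)
occurs-++ʳ u v {p} occ i i<v = begin
  t (p + length u + i)       ≡⟨ cong t (+-assoc p (length u) i) ⟩
  t (p + (length u + i))     ≡⟨ occ (length u + i) bound ⟩
  (u ++ v) ‼ (length u + i)  ≡⟨ ‼-++ʳ u v i ⟩
  v ‼ i                      ∎
  where
  bound : length u + i < length (u ++ v)
  bound = <-≤-trans (+-monoʳ-< (length u) i<v) (≤-reflexive (sym (length-++ u)))

-- Positions p and q of t agree on length ℓ: t[p … p+ℓ-1] = t[q … q+ℓ-1].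
-- (A record, so that p, q and ℓ can be inferred from the type.)
record Agree (p q ℓ : ℕ) : Set where
  constructor agree
  field letters : ∀ i → i < ℓ → t (p + i) ≡ t (q + i)
open Agree

agree-sym : ∀ {p q ℓ} → Agree p q ℓ → Agree q p ℓ
agree-sym a = agree λ i i<ℓ → sym (letters a i i<ℓ)

agree-trans : ∀ {p q r ℓ} → Agree p q ℓ → Agree q r ℓ → Agree p r ℓ
agree-trans a b = agree λ i i<ℓ → trans (letters a i i<ℓ) (letters b i i<ℓ)

agree-≤ : ∀ {p q ℓ ℓ′} → ℓ′ ≤ ℓ → Agree p q ℓ → Agree p q ℓ′
agree-≤ ℓ′≤ℓ a = agree λ i i<ℓ′ → letters a i (<-≤-trans i<ℓ′ ℓ′≤ℓ)

agree-++ : ∀ {p q m n} → Agree p q m → Agree (p + m) (q + m) n → Agree p q (m + n)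
agree-++ {p} {q} {m} {n} a b = agree combined
  where
  combined : ∀ i → i < m + n → t (p + i) ≡ t (q + i)
  combined i i<m+n with i <? m
  ... | yes i<m = letters a i i<m
  ... | no i≮m = subst (λ i → t (p + i) ≡ t (q + i)) m+j≡i (shifted (i ∸ m) j<n)
    where
    m+j≡i : m + (i ∸ m) ≡ i
    m+j≡i = m+[n∸m]≡n (≮⇒≥ i≮m)
    j<n : i ∸ m < n
    j<n = +-cancelˡ-< m (i ∸ m) n (subst (_< m + n) (sym m+j≡i) i<m+n)
    shifted : ∀ j → j < n → t (p + (m + j)) ≡ t (q + (m + j))
    shifted j j<n = begin
      t (p + (m + j))  ≡⟨ cong t (sym (+-assoc p m j)) ⟩
      t (p + m + j)    ≡⟨ letters b j j<n ⟩
      t (q + m + j)    ≡⟨ cong t (+-assoc q m j) ⟩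
      t (q + (m + j))  ∎

occurs-agree : ∀ w p q → Occurs w p → Occurs w q → Agree p q (length w)
occurs-agree w p q occ₁ occ₂ = agree λ i i<w → trans (occ₁ i i<w) (sym (occ₂ i i<w))

-- Block shifts, read off the prefix Sₙ₊₃ = Sₙ₊₂ Sₙ₊₁ Sₙ of t.
module _ (n : ℕ) where
  private
    S₂ S₁ S₀ : List (Fin 3)
    S₂ = σⁿ0 (2 + n)
    S₁ = σⁿ0 (1 + n)
    S₀ = σⁿ0 n

    after-S₂ : Occurs (S₁ ++ S₀) (length S₂)
    after-S₂ = occurs-++ʳ S₂ (S₁ ++ S₀) {0} (subst (λ w → Occurs w 0) (S-rec n) (S-occurs (3 + n)))

  shift-one : Agree (T (2 + n)) 0 (T (1 + n))
  shift-one = subst₂ (λ p ℓ → Agree p 0 ℓ) (length-S (2 + n)) (length-S (1 + n))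
    (occurs-agree S₁ (length S₂) 0 (occurs-++ˡ S₁ S₀ {length S₂} after-S₂) (S-occurs (1 + n)))

  shift-two : Agree (T (2 + n) + T (1 + n)) 0 (T n)
  shift-two = subst₂ (λ p ℓ → Agree p 0 ℓ) (cong₂ _+_ (length-S (2 + n)) (length-S (1 + n))) (length-S n)
    (occurs-agree S₀ (length S₂ + length S₁) 0 (occurs-++ʳ S₁ S₀ {length S₂} after-S₂) (S-occurs n))

halve : ∀ m n → (m * 2 + n) / 2 ≡ m + n / 2
halve m n = trans (+-distrib-/-∣ˡ n (n∣m*n m)) (cong (_+ n / 2) (m*n/n≡m m 2))

-- With p, q, r = T_{j-2}, T_{j-1}, T_j and T_{j+1}, T_{j+2}, T_{j+3} expanded:
-- T_{j+3} + T_{j+1} = 2 T_{j+2} + (T_j + T_{j-2}).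
numerator-identity : ∀ p q r →
  (r + q + p) + r + q + (r + q + p) + r + (r + q + p)
    ≡ ((r + q + p) + r + q) * 2 + (r + p)
numerator-identity = solve-∀

Lk-rec : ∀ m → Lk (5 + m) ≡ T (5 + m) + Lk (2 + m)
Lk-rec m = begin
  (T (6 + m) + T (4 + m) ∸ 3) / 2          ≡⟨ cong (λ x → (x ∸ 3) / 2) (numerator-identity (T (1 + m)) (T (2 + m)) (T (3 + m))) ⟩
  (T (5 + m) * 2 + w ∸ 3) / 2              ≡⟨ cong (_/ 2) (+-∸-assoc (T (5 + m) * 2) 3≤w) ⟩
  (T (5 + m) * 2 + (w ∸ 3)) / 2            ≡⟨ halve (T (5 + m)) (w ∸ 3) ⟩
  T (5 + m) + Lk (2 + m)                   ∎
  where
  w : ℕ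
  w = T (3 + m) + T (1 + m)
  3≤w : 3 ≤ w
  3≤w = ≤-trans (+-mono-≤ (+-mono-≤ (T-pos (2 + m)) (T-pos (1 + m))) (T-pos m)) (m≤m+n (T (3 + m)) _)

-- Doubling written as the product used by halve and m*n/n≡m.
twice : ∀ m → m + m ≡ m * 2
twice = solve-∀

-- L_{k+1} ≤ T_{k+2}: the numerator is at most 2 T_{k+2}.
Lk-bound : ∀ k → Lk (suc k) ≤ T (2 + k)
Lk-bound k = ≤-trans (/-monoˡ-≤ 2 numerator≤) (≤-reflexive (m*n/n≡m (T (2 + k)) 2))
  where
  numerator≤ : T (2 + k) + T k ∸ 3 ≤ T (2 + k) * 2
  numerator≤ = ≤-trans (m∸n≤m _ 3)
    (≤-trans (+-monoʳ-≤ (T (2 + k)) (≤-trans (T-mono k) (T-mono (1 + k))))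
             (≤-reflexive (twice (T (2 + k)))))

-- The inductive step k ↦ k + 3, cutting L_{k+3} = A + B + (C + L_k) with
-- A, B, C = T_{k+2}, T_{k+1}, T_k (here k = m + 2).
step : ∀ m → Agree 0 (T (2 + m)) (Lk (2 + m)) → Agree 0 (T (5 + m)) (Lk (5 + m))
step m ih = subst (Agree 0 (T (5 + m))) (sym L-split)
  (agree-++ {m = A} prefixA (agree-++ {m = B} pieceB pieceC))
  where
  A B C L : ℕ
  A = T (4 + m)
  B = T (3 + m)
  C = T (2 + m)
  L = Lk (2 + m)
  L≤B : L ≤ B
  L≤B = Lk-bound (1 + m)
  L-split : Lk (5 + m) ≡ A + (B + (C + L))
  L-split = trans (Lk-rec m) (trans (+-assoc (A + B) C L) (+-assoc A B (C + L)))
  C+L≤T : C + L ≤ T (5 + m)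
  C+L≤T = ≤-trans (+-monoʳ-≤ C L≤B)
    (≤-trans (≤-reflexive (+-comm C B)) (+-monoˡ-≤ C (m≤n+m B A)))
  prefixA : Agree 0 (T (5 + m)) A
  prefixA = agree-sym (shift-one (3 + m))
  pieceB : Agree A (T (5 + m) + A) B
  pieceB = agree-trans (shift-one (2 + m)) (agree-sym (shift-two (3 + m)))
  -- On the first C letters this is a block shift; from A + B + C = T_{k+3}
  -- on, the block shift by T_{k+3} and ih lead back to position C = T_k.
  pieceC-left : Agree (A + B) 0 (C + L)
  pieceC-left = agree-++ {m = C} (shift-two (2 + m))
    (agree-trans (agree-≤ (≤-trans L≤B (T-mono (3 + m))) (shift-one (3 + m))) ih)
  pieceC : Agree (A + B) (T (5 + m) + A + B) (C + L)
  pieceC = agree-trans pieceC-left (agree-sym (agree-≤ C+L≤T (shift-one (4 + m))))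

Certificate : List (Fin 3) → ℕ → ℕ → ℕ → Set
Certificate w p q ℓ =
  p + ℓ ≤ length w × q + ℓ ≤ length w × (∀ {i} → i < ℓ → w ‼ (p + i) ≡ w ‼ (q + i))

certificate? : ∀ w p q ℓ → Dec (Certificate w p q ℓ)
certificate? w p q ℓ =
  (p + ℓ ≤? length w) ×-dec (q + ℓ ≤? length w)
    ×-dec allUpTo? (λ i → ≡-dec _≟ᶠ_ (w ‼ (p + i)) (w ‼ (q + i))) ℓ

certified-agree : ∀ n {p q ℓ} → Certificate (σⁿ0 n) p q ℓ → Agree p q ℓ
certified-agree n {p} {q} (p+ℓ≤ , q+ℓ≤ , same) = agree λ i i<ℓ →
  trans (S-occurs n (p + i) (<-≤-trans (+-monoʳ-< p i<ℓ) p+ℓ≤))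
    (trans (same i<ℓ) (sym (S-occurs n (q + i) (<-≤-trans (+-monoʳ-< q i<ℓ) q+ℓ≤))))

-- The theorem for k = m + 2: base cases k = 2, 3, 4 by computation in S₆
-- (|S₆| = 44 ≥ T_4 + L_4 = 27), then steps of 3.
agree-T-L : ∀ m → Agree 0 (T (2 + m)) (Lk (2 + m))
agree-T-L 0 = certified-agree 6 (from-yes (certificate? (σⁿ0 6) 0 (T 2) (Lk 2)))
agree-T-L 1 = certified-agree 6 (from-yes (certificate? (σⁿ0 6) 0 (T 3) (Lk 3)))
agree-T-L 2 = certified-agree 6 (from-yes (certificate? (σⁿ0 6) 0 (T 4) (Lk 4)))
agree-T-L (suc (suc (suc m))) = step m (agree-T-L m)

mainTheorem18 : (k : ℕ) → 2 ≤ k →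
    (i : ℕ) → i < Lk k → t i ≡ t (T k + i)
mainTheorem18 (suc (suc m)) (s≤s (s≤s z≤n)) = letters (agree-T-L m)
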